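{- Let $G=(V,E)$ be a proper interval graph with a canonical ordering $v_1,v_2,\dots,v_n$ of its vertices, and let $A(G)$ be the augmented adjacency matrix of $G$ with rows and columns arranged in this order. Then the canonical sequence of $G$ with respect to this ordering equals the stair sequence of $A(G)$.
   Context: A proper interval graph has an interval representation with no interval properly containing another. A canonical ordering of a proper interval graph is an ordering $v_1,\dots,v_n$ such that $G$ has a proper interval representation $\{[a_i,b_i]\}$ with $a_i\ne b_j$ for all $i,j$, $a_1<\dots<a_n$, $b_1<\dots<b_n$; for such an ordering $A(G)$ has the consecutive 1's property (in every row and column the 1's are consecutive). The canonical sequence with respect to the ordering is obtained by listing the $2n$ endpoints $a_i,b_i$ in increasing order and replacing each $a_i$ and $b_i$ by $i$. The augmented adjacency matrix $A(G)$ is the adjacency matrix with all diagonal entries set to 1. The stair sequence of $A(G)$: partition the positions of $A(G)$ by a monotone polygonal path from the upper-left to the lower-right corner so that the part above/right of the path consists exactly of the zeros to the right of the principal diagonal, and write the column numbers (for horizontal steps) and row numbers (for vertical steps) in the order the path passes them. Concretely, with $U(i)=\max\{j\ge i: (A(G))_{ij}=1\}$ and $U(0)=0$, the stair sequence is obtained by, for $i=1,2,\dots,n$ in turn, writing $U(i-1)+1,\dots,U(i)$ followed by $i$; it is a sequence over $\{1,\dots,n\}$ in which each number occurs exactly twice.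
   Formalization: The interval endpoints $a_i,b_i$ of the canonical representation are rational numbers. -}

module Defs where

open import Data.Bool using (Bool; true; false; if_then_else_; _∧_)
open import Data.Nat using (ℕ; zero; suc; _+_; _∸_; _⊔_; _≤ᵇ_)
open import Data.Fin using (Fin; toℕ; _≟_)
open import Data.List using (List; []; _∷_; _++_; map; upTo; foldr)
open import Data.List using (allFin) public
open import Data.Product using (_×_; _,_; proj₁; proj₂)
open import Data.Rational using (ℚ; _≤_; _<_) renaming (_≤ᵇ_ to _≤ℚᵇ_)
open import Relation.Nullary using (¬_; does)
open import Relation.Binary.PropositionalEquality using (_≡_)

-- A finite simple graph on the vertex set {v_1,…,v_n}, identified with Fin n
-- (vertex v_i is the element of Fin n with toℕ = i - 1), given by its
-- 0/1 adjacency matrix.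
record Graph (n : ℕ) : Set where
  field
    adj       : Fin n → Fin n → Bool
    symmetric : ∀ i j → adj i j ≡ adj j i
    irreflexive : ∀ i → adj i i ≡ false
open Graph public

augAdj : ∀ {n} → Graph n → Fin n → Fin n → Bool
augAdj G i j = if does (i ≟ j) then true else adj G i j

-- The vertex ordering v_1,…,v_n (the order of Fin n) is a canonical ordering
-- witnessed by the interval representation {[a_i, b_i]}: it is an interval
-- representation of G (adjacent iff intervals intersect), proper (no interval
-- properly contains another), a_i ≠ b_j for all i,j, a_1<…<a_n, b_1<…<b_n.
record CanonicalRep {n : ℕ} (G : Graph n) (a b : Fin n → ℚ) : Set where
  field
    interval   : ∀ i → a i ≤ b i
    represents : ∀ i j → ¬ (i ≡ j) →
                 (adj G i j ≡ true → (a i ≤ b j × a j ≤ b i)) ×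
                 ((a i ≤ b j × a j ≤ b i) → adj G i j ≡ true)
    proper     : ∀ i j → ¬ (i ≡ j) → ¬ (a i ≤ a j × b j ≤ b i)
    distinct   : ∀ i j → ¬ (a i ≡ b j)
    a-increasing : ∀ i j → toℕ i Data.Nat.< toℕ j → a i < a j
    b-increasing : ∀ i j → toℕ i Data.Nat.< toℕ j → b i < b j

insertEP : ℚ × ℕ → List (ℚ × ℕ) → List (ℚ × ℕ)
insertEP x [] = x ∷ []
insertEP x (y ∷ ys) =
  if proj₁ x ≤ℚᵇ proj₁ y then x ∷ y ∷ ys else y ∷ insertEP x ys

sortEP : List (ℚ × ℕ) → List (ℚ × ℕ)
sortEP = foldr insertEP []

endpoints : ∀ {n} → (Fin n → ℚ) → (Fin n → ℚ) → List (ℚ × ℕ)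
endpoints {n} a b =
  foldr (λ i rest → (a i , suc (toℕ i)) ∷ (b i , suc (toℕ i)) ∷ rest) [] (allFin n)

canonicalSeq : ∀ {n} → (Fin n → ℚ) → (Fin n → ℚ) → List ℕ
canonicalSeq a b = map proj₂ (sortEP (endpoints a b))

-- U(i) = max { j ≥ i : A(G)_{ij} = 1 }   (1-based value; vertex i is Fin index)
U : ∀ {n} → Graph n → Fin n → ℕ
U {n} G i =
  foldr (λ j m → if (toℕ i ≤ᵇ toℕ j) ∧ augAdj G i j then suc (toℕ j) ⊔ m else m)
        0 (allFin n)

-- The list m, m+1, …, k  (empty if k < m).
range : ℕ → ℕ → List ℕ
range m k = map (m +_) (upTo (suc k ∸ m))

-- For i = 1..n in turn: write U(i-1)+1,…,U(i) followed by i  (U(0) = 0).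
stairAux : ∀ {n} → Graph n → List (Fin n) → ℕ → List ℕ
stairAux G [] prev = []
stairAux G (i ∷ is) prev =
  range (suc prev) (U G i) ++ (suc (toℕ i) ∷ stairAux G is (U G i))

stairSeq : ∀ {n} → Graph n → List ℕ
stairSeq {n} G = stairAux G (allFin n) 0

-- With U as in the stair sequence, everything rests on  a_k < b_i ⇔ k ≤ U(i).
-- If k ≤ U(i) then a_k ≤ a_{U(i)} ≤ b_i, as v_i and v_{U(i)} are adjacent (or equal); if
-- k > U(i) ≥ i and a_k ≤ b_i, the intervals of v_i and v_k overlap, making v_k adjacent to
-- v_i against the maximality of U(i).
-- Consequently U is nondecreasing, and listing, for i = 1, …, n, the left endpoints
-- a_{U(i-1)+1}, …, a_{U(i)} followed by b_i enumerates the 2n endpoints in strictly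
-- increasing order; its labels are exactly the stair sequence.  All endpoints are distinct,
-- and a strictly sorted list is determined by its set of members, so sorting the endpoints
-- produces this very list.

module Submission where

open import Defs
open import Data.Nat using (ℕ)
open import Data.Fin using (Fin)
open import Data.Rational using (ℚ)
open import Relation.Binary.PropositionalEquality using (_≡_)

open import Data.Bool using (Bool; true; false; T; if_then_else_; _∧_)
open import Data.Bool.Properties using (T-∧; T-≡)
open import Data.Empty using (⊥-elim)
import Data.Fin as F
open F using (toℕ; fromℕ<)
import Data.Fin.Properties as FP
open import Data.List using (List; []; _∷_; _++_; map; filter; foldr)
import Data.List.Properties as LP
open import Data.List.Membership.Propositional using (_∈_)
open import Data.List.Membership.Propositional.Properties
  using (∈-map⁺; ∈-map⁻; ∈-filter⁺; ∈-filter⁻; ∈-allFin; ∈-++⁺ˡ; ∈-++⁺ʳ; ∈-upTo⁺; ∈-upTo⁻)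
open import Data.List.Relation.Binary.Subset.Propositional using (_⊆_)
open import Data.List.Relation.Binary.Permutation.Propositional
  using (_↭_; ↭-refl; ↭-sym; ↭-trans; prep; swap)
open import Data.List.Relation.Binary.Permutation.Propositional.Properties
  using (∈-resp-↭; All-resp-↭)
open import Data.List.Relation.Unary.All as All using (All; []; _∷_)
import Data.List.Relation.Unary.All.Properties as AllP
open import Data.List.Relation.Unary.Any using (here; there)
open import Data.List.Relation.Unary.AllPairs as AllPairs using (AllPairs; []; _∷_)
import Data.List.Relation.Unary.AllPairs.Properties as AllPairsP
open import Data.List.Relation.Unary.Unique.Propositional.Properties using (allFin⁺)
open import Data.Nat
  using (zero; suc; _+_; _∸_; _⊔_; _≤_; _<_; _≤ᵇ_; z≤n; s≤s; s≤s⁻¹; _≤?_; _<?_)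
import Data.Nat.Properties as NP
open import Data.Product using (_×_; _,_; proj₁; proj₂; ∃-syntax)
import Data.Product as Product
open import Data.Sum using (_⊎_; inj₁; inj₂)
import Data.Sum as Sum
import Data.Rational as Q
import Data.Rational.Properties as QP
open import Function using (_∘_; _on_; id; Equivalence)
open import Relation.Binary using (Rel; Asymmetric; tri<; tri≈; tri>)
open import Relation.Binary.PropositionalEquality
  using (refl; sym; trans; cong; cong₂; subst; _≢_; module ≡-Reasoning)
open import Relation.Nullary using (yes; no)
open import Relation.Nullary.Decidable using (_×-dec_; dec-true; dec-false)

open Equivalence using (to; from)

AllPairs-⊆-antisym : ∀ {a r} {A : Set a} {R : Rel A r} → Asymmetric R →
  ∀ {xs ys} → AllPairs R xs → AllPairs R ys → xs ⊆ ys → ys ⊆ xs → xs ≡ ys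
AllPairs-⊆-antisym asym {[]} {[]} _ _ _ _ = refl
AllPairs-⊆-antisym asym {[]} {y ∷ ys} _ _ _ ys⊆xs with ys⊆xs (here refl)
... | ()
AllPairs-⊆-antisym asym {x ∷ xs} {[]} _ _ xs⊆ys _ with xs⊆ys (here refl)
... | ()
AllPairs-⊆-antisym {R = R} asym {x ∷ xs} {y ∷ ys} (x<xs ∷ xs↗) (y<ys ∷ ys↗) xs⊆ys ys⊆xs =
  cong₂ _∷_ x≡y
    (AllPairs-⊆-antisym asym xs↗ ys↗ (⊆-tail x≡y x<xs xs⊆ys) (⊆-tail (sym x≡y) y<ys ys⊆xs))
  where
  x≡y : x ≡ y
  x≡y with xs⊆ys (here refl) | ys⊆xs (here refl)
  ... | here x≡y   | _          = x≡y
  ... | there _    | here y≡x   = sym y≡x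
  ... | there x∈ys | there y∈xs = ⊥-elim (asym (All.lookup x<xs y∈xs) (All.lookup y<ys x∈ys))
  ⊆-tail : ∀ {u v us vs} → u ≡ v → All (R u) us → u ∷ us ⊆ v ∷ vs → us ⊆ vs
  ⊆-tail refl u<us u∷us⊆ z∈us with u∷us⊆ (there z∈us)
  ... | here refl  = ⊥-elim (asym (All.lookup u<us z∈us) (All.lookup u<us z∈us))
  ... | there z∈vs = z∈vs

≤∧≢⇒< : ∀ {p q : ℚ} → p Q.≤ q → p ≢ q → p Q.< q
≤∧≢⇒< {p} {q} p≤q p≢q with q QP.≤? p
... | yes q≤p = ⊥-elim (p≢q (QP.≤-antisym p≤q q≤p))
... | no q≰p  = QP.≰⇒> q≰p

_<ₖ_ : ℚ × ℕ → ℚ × ℕ → Set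
_<ₖ_ = Q._<_ on proj₁

insertEP-↭ : ∀ x ys → insertEP x ys ↭ x ∷ ys
insertEP-↭ x [] = ↭-refl
insertEP-↭ x (y ∷ ys) with proj₁ x Q.≤ᵇ proj₁ y
... | true  = ↭-refl
... | false = ↭-trans (prep y (insertEP-↭ x ys)) (swap y x ↭-refl)

sortEP-↭ : ∀ xs → sortEP xs ↭ xs
sortEP-↭ [] = ↭-refl
sortEP-↭ (x ∷ xs) = ↭-trans (insertEP-↭ x (sortEP xs)) (prep x (sortEP-↭ xs))

insertEP-sorted : ∀ x {ys} → All (λ y → proj₁ x ≢ proj₁ y) ys →
  AllPairs _<ₖ_ ys → AllPairs _<ₖ_ (insertEP x ys)
insertEP-sorted x [] [] = [] ∷ []
insertEP-sorted x {y ∷ ys} (x≢y ∷ x≢ys) (y<ys ∷ ys↗) with proj₁ x Q.≤ᵇ proj₁ y in x≤ᵇy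
... | true  = (x<y ∷ All.map (QP.<-trans x<y) y<ys) ∷ y<ys ∷ ys↗
  where
  x<y = ≤∧≢⇒< (QP.≤ᵇ⇒≤ (from T-≡ x≤ᵇy)) x≢y
... | false = All-resp-↭ (↭-sym (insertEP-↭ x ys)) (y<x ∷ y<ys) ∷ insertEP-sorted x x≢ys ys↗
  where
  y<x = QP.≰⇒> (λ x≤y → subst T x≤ᵇy (QP.≤⇒≤ᵇ x≤y))

sortEP-sorted : ∀ {xs} → AllPairs (_≢_ on proj₁) xs → AllPairs _<ₖ_ (sortEP xs)
sortEP-sorted [] = []
sortEP-sorted {x ∷ xs} (x≢xs ∷ xs≢) =
  insertEP-sorted x (All-resp-↭ (↭-sym (sortEP-↭ xs)) x≢xs) (sortEP-sorted xs≢)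

sortEP-unique : ∀ {xs ys} → AllPairs (_≢_ on proj₁) xs → AllPairs _<ₖ_ ys →
  xs ⊆ ys → ys ⊆ xs → sortEP xs ≡ ys
sortEP-unique {xs} xs≢ ys↗ xs⊆ys ys⊆xs =
  AllPairs-⊆-antisym QP.<-asym (sortEP-sorted xs≢) ys↗
    (λ z∈ → xs⊆ys (∈-resp-↭ (sortEP-↭ xs) z∈))
    (λ z∈ → ∈-resp-↭ (↭-sym (sortEP-↭ xs)) (ys⊆xs z∈))

maxWhere : ∀ {a} {A : Set a} → (A → Bool) → (A → ℕ) → List A → ℕ
maxWhere p f = foldr (λ x m → if p x then f x ⊔ m else m) 0

module _ {a} {A : Set a} (p : A → Bool) (f : A → ℕ) where

  maxWhere-≤ : ∀ {c} → (∀ x → f x ≤ c) → ∀ xs → maxWhere p f xs ≤ c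
  maxWhere-≤ f≤c [] = z≤n
  maxWhere-≤ f≤c (x ∷ xs) with p x
  ... | true  = NP.⊔-lub (f≤c x) (maxWhere-≤ f≤c xs)
  ... | false = maxWhere-≤ f≤c xs

  ≤-maxWhere : ∀ {x xs} → x ∈ xs → T (p x) → f x ≤ maxWhere p f xs
  ≤-maxWhere {xs = y ∷ xs} x∈ px with p y in py
  ≤-maxWhere (here refl)  px | true  = NP.m≤m⊔n _ _
  ≤-maxWhere (there x∈xs) px | true  = NP.≤-trans (≤-maxWhere x∈xs px) (NP.m≤n⊔m _ _)
  ≤-maxWhere (here refl)  px | false = ⊥-elim (subst T py px)
  ≤-maxWhere (there x∈xs) px | false = ≤-maxWhere x∈xs px

  maxWhere-attained : ∀ xs → maxWhere p f xs ≡ 0 ⊎ ∃[ x ] T (p x) × maxWhere p f xs ≡ f x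
  maxWhere-attained [] = inj₁ refl
  maxWhere-attained (x ∷ xs) with p x in px
  ... | false = maxWhere-attained xs
  ... | true with NP.⊔-sel (f x) (maxWhere p f xs)
  ...   | inj₁ max≡fx = inj₂ (x , from T-≡ px , max≡fx)
  ...   | inj₂ max≡m  =
    Sum.map (trans max≡m) (Product.map₂ (Product.map₂ (trans max≡m))) (maxWhere-attained xs)

∈-range⁻ : ∀ m u {k} → k ∈ range m u → m ≤ k × k ≤ u
∈-range⁻ m u k∈ with ∈-map⁻ (m +_) k∈
... | i , i∈ , refl = NP.m≤m+n m i , s≤s⁻¹ m+i<1+u
  where
  i<1+u∸m : i < suc u ∸ m
  i<1+u∸m = ∈-upTo⁻ i∈
  m≤1+u : m ≤ suc u
  m≤1+u = NP.<⇒≤ (NP.m∸n≢0⇒n<m (λ 1+u∸m≡0 → NP.n≮0 (subst (i <_) 1+u∸m≡0 i<1+u∸m)))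
  m+i<1+u : m + i < suc u
  m+i<1+u = subst (m + i <_) (NP.m+[n∸m]≡n m≤1+u) (NP.+-monoʳ-< m i<1+u∸m)

∈-range⁺ : ∀ m u {k} → m ≤ k → k ≤ u → k ∈ range m u
∈-range⁺ m u m≤k k≤u =
  subst (_∈ range m u) (NP.m+[n∸m]≡n m≤k) (∈-map⁺ (m +_) (∈-upTo⁺ (NP.∸-monoˡ-< (s≤s k≤u) m≤k)))

range-sorted : ∀ m u → AllPairs _<_ (range m u)
range-sorted m u =
  AllPairsP.map⁺ (AllPairsP.applyUpTo⁺₁ id (suc u ∸ m) (λ i<j _ → NP.+-monoʳ-< m i<j))

allFin-sorted : ∀ n → AllPairs F._<_ (allFin n)
allFin-sorted n = AllPairsP.tabulate⁺-< id

-- The vertices with 0-based index in [m, u), i.e. v_{m+1}, …, v_u.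
between : ∀ {n} → ℕ → ℕ → List (Fin n)
between {n} m u = filter (λ j → m ≤? toℕ j ×-dec toℕ j <? u) (allFin n)

∈-between⁻ : ∀ {n m u} {j : Fin n} → j ∈ between m u → m ≤ toℕ j × toℕ j < u
∈-between⁻ {m = m} {u} = proj₂ ∘ ∈-filter⁻ (λ j → m ≤? toℕ j ×-dec toℕ j <? u) {xs = allFin _}

∈-between⁺ : ∀ {n m u} {j : Fin n} → m ≤ toℕ j → toℕ j < u → j ∈ between m u
∈-between⁺ {m = m} {u} {j} m≤j j<u =
  ∈-filter⁺ (λ j → m ≤? toℕ j ×-dec toℕ j <? u) (∈-allFin j) (m≤j , j<u)

map-suc-toℕ-between : ∀ {n m u} → u ≤ n → map (suc ∘ toℕ) (between {n} m u) ≡ range (suc m) u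
map-suc-toℕ-between {n} {m} {u} u≤n =
  AllPairs-⊆-antisym NP.<-asym labels-sorted (range-sorted (suc m) u) labels⊆range range⊆labels
  where
  labels = map (suc ∘ toℕ) (between {n} m u)
  labels-sorted : AllPairs _<_ labels
  labels-sorted = AllPairsP.map⁺ (AllPairsP.filter⁺ _ (AllPairs.map s≤s (allFin-sorted n)))
  labels⊆range : labels ⊆ range (suc m) u
  labels⊆range k∈ with ∈-map⁻ (suc ∘ toℕ) k∈
  ... | j , j∈ , refl = ∈-range⁺ (suc m) u (s≤s (proj₁ (∈-between⁻ j∈))) (proj₂ (∈-between⁻ j∈))
  range⊆labels : range (suc m) u ⊆ labels
  range⊆labels {zero} k∈ with ∈-range⁻ (suc m) u k∈
  ... | () , _
  range⊆labels {suc k} k∈ with ∈-range⁻ (suc m) u k∈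
  ... | s≤s m≤k , k<u with fromℕ< (NP.<-≤-trans k<u u≤n) | FP.toℕ-fromℕ< (NP.<-≤-trans k<u u≤n)
  ...   | j | refl = ∈-map⁺ (suc ∘ toℕ) (∈-between⁺ m≤k k<u)

strictMono⇒mono : ∀ {n} {f : Fin n → ℚ} → (∀ i j → toℕ i < toℕ j → f i Q.< f j) →
  ∀ {i j} → toℕ i ≤ toℕ j → f i Q.≤ f j
strictMono⇒mono f↗ {i} {j} i≤j with NP.m≤n⇒m<n∨m≡n i≤j
... | inj₁ i<j = QP.<⇒≤ (f↗ i j i<j)
... | inj₂ i≡j rewrite FP.toℕ-injective i≡j = QP.≤-refl

strictMono⇒injective : ∀ {n} {f : Fin n → ℚ} → (∀ i j → toℕ i < toℕ j → f i Q.< f j) →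
  ∀ {i j} → i ≢ j → f i ≢ f j
strictMono⇒injective f↗ {i} {j} i≢j fi≡fj with NP.<-cmp (toℕ i) (toℕ j)
... | tri< i<j _ _ = QP.<-irrefl fi≡fj (f↗ i j i<j)
... | tri≈ _ i≡j _ = i≢j (FP.toℕ-injective i≡j)
... | tri> _ _ j<i = QP.<-irrefl (sym fi≡fj) (f↗ j i j<i)

module _ {n} (G : Graph n) where

  augAdj-refl : ∀ i → augAdj G i i ≡ true
  augAdj-refl i rewrite dec-true (i F.≟ i) refl = refl

  augAdj-≢ : ∀ {i j} → i ≢ j → augAdj G i j ≡ adj G i j
  augAdj-≢ {i} {j} i≢j rewrite dec-false (i F.≟ j) i≢j = refl

  -- U G i unfolds to maxWhere (upperNeighbour i) (suc ∘ toℕ) (allFin n).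
  private
    upperNeighbour : Fin n → Fin n → Bool
    upperNeighbour i j = (toℕ i ≤ᵇ toℕ j) ∧ augAdj G i j

  U-upper : ∀ i → U G i ≤ n
  U-upper i = maxWhere-≤ (upperNeighbour i) (suc ∘ toℕ) FP.toℕ<n (allFin n)

  U-lower : ∀ {i j} → toℕ i ≤ toℕ j → augAdj G i j ≡ true → toℕ j < U G i
  U-lower {i} {j} i≤j ij = ≤-maxWhere (upperNeighbour i) (suc ∘ toℕ) (∈-allFin j)
    (from T-∧ (NP.≤⇒≤ᵇ i≤j , from T-≡ ij))

  toℕ<U : ∀ i → toℕ i < U G i
  toℕ<U i = U-lower NP.≤-refl (augAdj-refl i)

  U-attained : ∀ i → ∃[ j ] toℕ i ≤ toℕ j × augAdj G i j ≡ true × U G i ≡ suc (toℕ j)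
  U-attained i with maxWhere-attained (upperNeighbour i) (suc ∘ toℕ) (allFin n)
  ... | inj₁ U≡0 = ⊥-elim (NP.n≮0 (subst (toℕ i <_) U≡0 (toℕ<U i)))
  ... | inj₂ (j , ij , U≡) =
    j , NP.≤ᵇ⇒≤ _ _ (proj₁ (to T-∧ ij)) , to T-≡ (proj₂ (to T-∧ ij)) , U≡

module Stair {n} (G : Graph n) (a b : Fin n → ℚ) where

  aPoint bPoint : Fin n → ℚ × ℕ
  aPoint j = a j , suc (toℕ j)
  bPoint j = b j , suc (toℕ j)

  endpointsOf : List (Fin n) → List (ℚ × ℕ)
  endpointsOf = foldr (λ i rest → aPoint i ∷ bPoint i ∷ rest) []

  stairPoints : List (Fin n) → ℕ → List (ℚ × ℕ)
  stairPoints [] prev = []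
  stairPoints (i ∷ is) prev =
    map aPoint (between prev (U G i)) ++ bPoint i ∷ stairPoints is (U G i)

  map-proj₂-stairPoints : ∀ is prev → map proj₂ (stairPoints is prev) ≡ stairAux G is prev
  map-proj₂-stairPoints [] prev = refl
  map-proj₂-stairPoints (i ∷ is) prev = begin
    map proj₂ (map aPoint chunk ++ bPoint i ∷ rest)
      ≡⟨ LP.map-++ proj₂ (map aPoint chunk) _ ⟩
    map proj₂ (map aPoint chunk) ++ suc (toℕ i) ∷ map proj₂ rest
      ≡⟨ cong₂ _++_ (sym (LP.map-∘ chunk))
                    (cong (suc (toℕ i) ∷_) (map-proj₂-stairPoints is (U G i))) ⟩
    map (suc ∘ toℕ) chunk ++ suc (toℕ i) ∷ stairAux G is (U G i)
      ≡⟨ cong (_++ _) (map-suc-toℕ-between (U-upper G i)) ⟩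
    range (suc prev) (U G i) ++ suc (toℕ i) ∷ stairAux G is (U G i)
      ∎
    where
    open ≡-Reasoning
    chunk = between prev (U G i)
    rest = stairPoints is (U G i)

  All-endpointsOf : ∀ {p} {P : ℚ × ℕ → Set p} {is} →
    All (λ j → P (aPoint j) × P (bPoint j)) is → All P (endpointsOf is)
  All-endpointsOf [] = []
  All-endpointsOf ((Pa , Pb) ∷ Ps) = Pa ∷ Pb ∷ All-endpointsOf Ps

  aPoint∈endpointsOf : ∀ {j is} → j ∈ is → aPoint j ∈ endpointsOf is
  aPoint∈endpointsOf (here refl) = here refl
  aPoint∈endpointsOf (there j∈) = there (there (aPoint∈endpointsOf j∈))

  bPoint∈endpointsOf : ∀ {j is} → j ∈ is → bPoint j ∈ endpointsOf is
  bPoint∈endpointsOf (here refl) = there (here refl)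
  bPoint∈endpointsOf (there j∈) = there (there (bPoint∈endpointsOf j∈))

  aPoint∈stairPoints : ∀ {i j is prev} → i ∈ is → prev ≤ toℕ j → toℕ j < U G i →
    aPoint j ∈ stairPoints is prev
  aPoint∈stairPoints {i} {j} {i' ∷ is} {prev} i∈ prev≤j j<Ui with toℕ j <? U G i'
  ... | yes j<Ui' = ∈-++⁺ˡ (∈-map⁺ aPoint (∈-between⁺ prev≤j j<Ui'))
  ... | no j≮Ui' with i∈
  ...   | here refl  = ⊥-elim (j≮Ui' j<Ui)
  ...   | there i∈is = ∈-++⁺ʳ _ (there (aPoint∈stairPoints i∈is (NP.≮⇒≥ j≮Ui') j<Ui))

  bPoint∈stairPoints : ∀ {j is} prev → j ∈ is → bPoint j ∈ stairPoints is prev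
  bPoint∈stairPoints {is = i ∷ _} prev (here refl) =
    ∈-++⁺ʳ (map aPoint (between prev (U G i))) (here refl)
  bPoint∈stairPoints {is = i ∷ _} prev (there j∈) =
    ∈-++⁺ʳ (map aPoint (between prev (U G i))) (there (bPoint∈stairPoints (U G i) j∈))

  endpoints⊆stairPoints : endpointsOf (allFin n) ⊆ stairPoints (allFin n) 0
  endpoints⊆stairPoints =
    All.lookup (All-endpointsOf {P = _∈ stairPoints (allFin n) 0} {allFin n} (All.tabulate λ {j} _ →
      aPoint∈stairPoints (∈-allFin j) z≤n (toℕ<U G j) , bPoint∈stairPoints 0 (∈-allFin j)))

  module _ (rep : CanonicalRep G a b) where
    open CanonicalRep rep

    augAdj⇒a≤b : ∀ {i j} → augAdj G i j ≡ true → a j Q.≤ b i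
    augAdj⇒a≤b {i} {j} ij with i F.≟ j
    ... | yes refl = interval i
    ... | no i≢j   = proj₂ (proj₁ (represents i j i≢j) ij)

    a<b-below-U : ∀ {i k} → toℕ k < U G i → a k Q.< b i
    a<b-below-U {i} {k} k<Ui with U-attained G i
    ... | j , _ , ij , Ui≡ =
      ≤∧≢⇒< (QP.≤-trans (strictMono⇒mono a-increasing k≤j) (augAdj⇒a≤b ij)) (distinct k i)
      where
      k≤j : toℕ k ≤ toℕ j
      k≤j = s≤s⁻¹ (subst (toℕ k <_) Ui≡ k<Ui)

    b<a-above-U : ∀ {i k} → U G i ≤ toℕ k → b i Q.< a k
    b<a-above-U {i} {k} Ui≤k =
      QP.≰⇒> λ ak≤bi → NP.<⇒≱ (U-lower G (NP.<⇒≤ i<k) (overlap⇒augAdj ak≤bi)) Ui≤k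
      where
      i<k : toℕ i < toℕ k
      i<k = NP.<-≤-trans (toℕ<U G i) Ui≤k
      i≢k : i ≢ k
      i≢k i≡k = NP.<-irrefl (cong toℕ i≡k) i<k
      ai≤bk : a i Q.≤ b k
      ai≤bk = QP.≤-trans (QP.<⇒≤ (a-increasing i k i<k)) (interval k)
      overlap⇒augAdj : a k Q.≤ b i → augAdj G i k ≡ true
      overlap⇒augAdj ak≤bi = trans (augAdj-≢ G i≢k) (proj₂ (represents i k i≢k) (ai≤bk , ak≤bi))

    U-mono : ∀ {i i'} → toℕ i ≤ toℕ i' → U G i ≤ U G i'
    U-mono {i} {i'} i≤i' with U-attained G i
    ... | j , _ , _ , Ui≡ = NP.≮⇒≥ λ Ui'<Ui →
      QP.<-irrefl refl
        (QP.<-≤-trans (QP.<-trans (bi'<aj Ui'<Ui) aj<bi) (strictMono⇒mono b-increasing i≤i'))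
      where
      aj<bi : a j Q.< b i
      aj<bi = a<b-below-U (subst (toℕ j <_) (sym Ui≡) (NP.n<1+n (toℕ j)))
      bi'<aj : U G i' < U G i → b i' Q.< a j
      bi'<aj Ui'<Ui = b<a-above-U (s≤s⁻¹ (subst (U G i' <_) Ui≡ Ui'<Ui))

    All-stairPoints : ∀ {p} {P : ℚ × ℕ → Set p} {is prev} →
      AllPairs F._<_ is → All (λ i → prev ≤ U G i) is →
      (∀ j → prev ≤ toℕ j → P (aPoint j)) → All (P ∘ bPoint) is → All P (stairPoints is prev)
    All-stairPoints [] [] _ [] = []
    All-stairPoints {is = i ∷ is} (i<is ∷ is↗) (prev≤Ui ∷ _) Pa (Pbi ∷ Pb) =
      AllP.++⁺ (AllP.map⁺ (All.tabulate (λ j∈ → Pa _ (proj₁ (∈-between⁻ j∈)))))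
        (Pbi ∷ All-stairPoints is↗ (All.map (U-mono ∘ NP.<⇒≤) i<is)
                 (λ j Ui≤j → Pa j (NP.≤-trans prev≤Ui Ui≤j)) Pb)

    stairPoints-sorted : ∀ {is prev} → AllPairs F._<_ is → AllPairs _<ₖ_ (stairPoints is prev)
    stairPoints-sorted [] = []
    stairPoints-sorted {i ∷ is} {prev} (i<is ∷ is↗) =
      AllPairsP.++⁺ chunk-sorted (bi<rest ∷ stairPoints-sorted is↗) chunk<rest
      where
      chunk = between prev (U G i)
      rest = stairPoints is (U G i)
      chunk-sorted : AllPairs _<ₖ_ (map aPoint chunk)
      chunk-sorted =
        AllPairsP.map⁺ (AllPairsP.filter⁺ _ (AllPairs.map (a-increasing _ _) (allFin-sorted n)))
      bi<rest : All (bPoint i <ₖ_) rest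
      bi<rest = All-stairPoints is↗ (All.map (U-mono ∘ NP.<⇒≤) i<is) (λ _ → b<a-above-U)
        (All.map (b-increasing i _) i<is)
      chunk<rest : All (λ x → All (x <ₖ_) (bPoint i ∷ rest)) (map aPoint chunk)
      chunk<rest = AllP.map⁺ (All.tabulate λ j∈ →
        let aj<bi = a<b-below-U (proj₂ (∈-between⁻ j∈))
        in  aj<bi ∷ All.map (QP.<-trans aj<bi) bi<rest)

    endpointsOf-distinct : ∀ {is} → AllPairs _≢_ is → AllPairs (_≢_ on proj₁) (endpointsOf is)
    endpointsOf-distinct [] = []
    endpointsOf-distinct {i ∷ _} (i≢is ∷ is≢) =
        (distinct i i ∷ All-endpointsOf (All.map (λ i≢j → a-≢ i≢j , distinct i _) i≢is))
      ∷ All-endpointsOf (All.map (λ i≢j → (λ bi≡aj → distinct _ i (sym bi≡aj)) , b-≢ i≢j) i≢is)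
      ∷ endpointsOf-distinct is≢
      where
      a-≢ = strictMono⇒injective a-increasing
      b-≢ = strictMono⇒injective b-increasing

    stairPoints⊆endpoints : stairPoints (allFin n) 0 ⊆ endpointsOf (allFin n)
    stairPoints⊆endpoints =
      All.lookup (All-stairPoints {P = _∈ endpointsOf (allFin n)} (allFin-sorted n)
        (All.tabulate (λ _ → z≤n)) (λ j _ → aPoint∈endpointsOf (∈-allFin j))
        (All.tabulate (λ {j} _ → bPoint∈endpointsOf (∈-allFin j))))

proposition2p4 : (n : ℕ) (G : Graph n) (a b : Fin n → ℚ) →
    CanonicalRep G a b → canonicalSeq a b ≡ stairSeq G
proposition2p4 n G a b rep = begin
  canonicalSeq a b                      ≡⟨ cong (map proj₂) sortedEndpoints ⟩
  map proj₂ (stairPoints (allFin n) 0)  ≡⟨ map-proj₂-stairPoints (allFin n) 0 ⟩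
  stairSeq G                            ∎
  where
  open ≡-Reasoning
  open Stair G a b
  sortedEndpoints : sortEP (endpointsOf (allFin n)) ≡ stairPoints (allFin n) 0
  sortedEndpoints =
    sortEP-unique (endpointsOf-distinct rep (allFin⁺ n)) (stairPoints-sorted rep (allFin-sorted n))
      endpoints⊆stairPoints (stairPoints⊆endpoints rep)
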